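{- Let $a<b$ be integers with $b-a=k$, and let $\mathcal{A}$ be Algorithm $\mathcal{A}(a,b)$ (defined in the context). Then $\mathcal{A}$ uses $O(4^k k^k)$ words of space.
   Context: A word is the space needed to store one interval. Algorithm $\mathcal{A}(a,b)$, for integers $a<b$, processes a stream of closed unit-length intervals each contained in $[a,b)$. At initialisation, for each integer $i\in\{a+1,\dots,b-1\}$ it sets variables $L_i\gets\emptyset$, $R_i\gets\emptyset$ (each storing at most one interval) and creates recursive instances $\mathcal{T}^L_i$, $\mathcal{A}^L_i$ of $\mathcal{A}(a,i)$ and $\mathcal{T}^R_i$, $\mathcal{A}^R_i$ of $\mathcal{A}(i,b)$. When an interval $I$ arrives, for each such $i$: if $I\subseteq[i,b)$: feed $I$ into $\mathcal{T}^R_i$; if $R_i=\emptyset$ or $I$ has a strictly smaller left endpoint than $R_i$, set $R_i\gets I$; then if $R_i\ne\emptyset$, $I\cap R_i=\varnothing$ and $I$ has strictly larger right endpoint than $R_i$, feed $I$ into $\mathcal{A}^R_i$. If $I\subseteq[a,i)$: feed $I$ into $\mathcal{T}^L_i$; if $L_i=\emptyset$ or $I$ has strictly larger right endpoint than $L_i$, set $L_i\gets I$; then if $L_i\ne\emptyset$, $I\cap L_i=\varnothing$ and $I$ has strictly smaller left endpoint than $L_i$, feed $I$ into $\mathcal{A}^L_i$. The output is a largest set among $OUT(\mathcal{T}^L_i)\cup R_i\cup OUT(\mathcal{A}^R_i)$ and $OUT(\mathcal{A}^L_i)\cup L_i\cup OUT(\mathcal{T}^R_i)$ over all $i$. -}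

module Defs where

open import Data.Nat using (ℕ; zero; suc; _+_; _∸_)
open import Data.List using (List; map; upTo; drop)
open import Data.Nat.ListAction using (sum)
open import Data.Integer as ℤ using (ℤ; ∣_∣)

-- Words of memory held by an instance of Algorithm A(a,b) of width
-- k = b - a, computed with a fuel parameter (fuel ≥ width suffices, since
-- every recursive instance has strictly smaller width).
--
-- For each i ∈ {a+1,…,b-1}, write j = i - a ∈ {1,…,k-1}.  The instance stores
--   * the variable L_i   : 1 word
--   * the variable R_i   : 1 word
--   * T^L_i, A^L_i       : two instances of A(a,i), width j
--   * T^R_i, A^R_i       : two instances of A(i,b), width k - j
wordsF : ℕ → ℕ → ℕ
wordsF zero    k = 0
wordsF (suc f) k =
  sum (map (λ j → 1 + 1
                  + wordsF f j + wordsF f j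
                  + wordsF f (k ∸ j) + wordsF f (k ∸ j))
           (drop 1 (upTo k)))

wordsA : ℕ → ℕ
wordsA k = wordsF k k

spaceA : ℤ → ℤ → ℕ
spaceA a b = wordsA ∣ b ℤ.- a ∣

{-# OPTIONS --safe #-}
module Submission where

open import Defs
open import Data.Nat using (ℕ; _*_; _^_; _≤_)
open import Data.Integer using (ℤ; _<_; _+_; +_)
open import Data.Product using (∃-syntax; _,_)
open import Relation.Binary.PropositionalEquality using (_≡_)

open import Data.Integer using (∣_∣)
open import Data.Integer.Properties using (+-0-abelianGroup)
open import Algebra.Properties.AbelianGroup +-0-abelianGroup using (xyx⁻¹≈y)
open import Data.List using (List; map; length; applyUpTo)
open import Data.List.Properties using (length-applyUpTo)
open import Data.List.Relation.Unary.All using (All; []; _∷_)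
open import Data.List.Relation.Unary.All.Properties using (applyUpTo⁺₁)
open import Data.Nat as ℕ using (zero; suc; _∸_; z≤n; s≤s; _>_)
open import Data.Nat.ListAction using (sum)
open import Data.Nat.Properties
open import Data.Nat.Tactic.RingSolver using (solve-∀)
open import Relation.Binary.PropositionalEquality using (refl; sym; cong₂; subst)

-- The k - 1 split points of an instance of width k each hold two words and
-- four instances of width at most k - 1, so W(k) ≤ (k - 1)(2 + 4 W(k - 1)),
-- and 4^k k^k dominates this recurrence because it grows by a factor of at
-- least 4k from k - 1 to k, while the additive term 2(k - 1) stays below it.

envelope : ℕ → ℕ
envelope k = 4 ^ k * k ^ k

sum-map-≤ : ∀ (f : ℕ → ℕ) c {xs : List ℕ} → All (λ x → f x ≤ c) xs →
            sum (map f xs) ≤ length xs * c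
sum-map-≤ f c []       = z≤n
sum-map-≤ f c (p ∷ ps) = +-mono-≤ p (sum-map-≤ f c ps)

n≤4^n : ∀ n → n ≤ 4 ^ n
n≤4^n zero    = z≤n
n≤4^n (suc n) = begin
  suc n            ≤⟨ +-mono-≤ (m^n>0 4 n) (n≤4^n n) ⟩
  4 ^ n ℕ.+ 4 ^ n  ≤⟨ +-monoʳ-≤ (4 ^ n) (m≤m+n (4 ^ n) _) ⟩
  4 * 4 ^ n        ∎
  where open ≤-Reasoning

n^n>0 : ∀ n → n ^ n > 0
n^n>0 zero    = s≤s z≤n
n^n>0 (suc n) = m^n>0 (suc n) (suc n)

n≤envelope : ∀ n → n ≤ envelope n
n≤envelope n = ≤-trans (n≤4^n n) (m≤m*n (4 ^ n) (n ^ n) {{ℕ.>-nonZero (n^n>0 n)}})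

envelope-mono : ∀ {j n} → j ≤ n → envelope j ≤ envelope n
envelope-mono {n = zero}  z≤n = ≤-refl
envelope-mono {j} {suc m} j≤n =
  *-mono-≤ (^-monoʳ-≤ 4 j≤n) (≤-trans (^-monoˡ-≤ j j≤n) (^-monoʳ-≤ (suc m) j≤n))

suc-*-4*envelope≤envelope-suc : ∀ n → suc n * (4 * envelope n) ≤ envelope (suc n)
suc-*-4*envelope≤envelope-suc n = begin
  suc n * (4 * (4 ^ n * n ^ n))    ≡⟨ regroup (suc n) (4 ^ n) (n ^ n) ⟩
  4 * 4 ^ n * (suc n * n ^ n)      ≤⟨ *-monoʳ-≤ (4 * 4 ^ n) (*-monoʳ-≤ (suc n) (^-monoˡ-≤ n (n≤1+n n))) ⟩
  4 * 4 ^ n * (suc n * suc n ^ n)  ∎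
  where
  open ≤-Reasoning
  regroup : ∀ m x y → m * (4 * (x * y)) ≡ 4 * x * (m * y)
  regroup = solve-∀

envelope-recurrence : ∀ n → n * (2 ℕ.+ 4 * envelope n) ≤ envelope (suc n)
envelope-recurrence n = begin
  n * (2 ℕ.+ 4 * e)      ≡⟨ *-distribˡ-+ n 2 (4 * e) ⟩
  n * 2 ℕ.+ n * (4 * e)  ≤⟨ +-monoˡ-≤ (n * (4 * e)) 2n≤4e ⟩
  4 * e ℕ.+ n * (4 * e)  ≤⟨ suc-*-4*envelope≤envelope-suc n ⟩
  envelope (suc n)       ∎
  where
  open ≤-Reasoning
  e : ℕ
  e = envelope n
  2n≤4e : n * 2 ≤ 4 * e
  2n≤4e = subst (_≤ 4 * e) (*-comm 2 n) (*-mono-≤ {2} {4} (s≤s (s≤s z≤n)) (n≤envelope n))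

wordsF-suc-≤ : ∀ f n c → (∀ {j} → j ≤ n → wordsF f j ≤ c) →
               wordsF (suc f) (suc n) ≤ n * (2 ℕ.+ 4 * c)
-- drop 1 (upTo (suc n)) reduces to applyUpTo suc n, the split points 1 … n.
wordsF-suc-≤ f n c ≤c = begin
  sum (map split (applyUpTo suc n))  ≤⟨ sum-map-≤ split c′ (applyUpTo⁺₁ suc n split≤c′) ⟩
  length (applyUpTo suc n) * c′      ≡⟨ cong₂ _*_ (length-applyUpTo suc n) (2+4x-unfolded c) ⟩
  n * (2 ℕ.+ 4 * c)                  ∎
  where
  open ≤-Reasoning
  w : ℕ → ℕ
  w = wordsF f
  split : ℕ → ℕ
  split j = 1 ℕ.+ 1 ℕ.+ w j ℕ.+ w j ℕ.+ w (suc n ∸ j) ℕ.+ w (suc n ∸ j)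
  c′ : ℕ
  c′ = 1 ℕ.+ 1 ℕ.+ c ℕ.+ c ℕ.+ c ℕ.+ c
  2+4x-unfolded : ∀ x → 1 ℕ.+ 1 ℕ.+ x ℕ.+ x ℕ.+ x ℕ.+ x ≡ 2 ℕ.+ 4 * x
  2+4x-unfolded = solve-∀
  split≤c′ : ∀ {i} → i ℕ.< n → split (suc i) ≤ c′
  split≤c′ {i} i<n = +-mono-≤ (+-mono-≤ (+-mono-≤ (+-mono-≤ ≤-refl left) left) right) right
    where
    left : w (suc i) ≤ c
    left = ≤c i<n
    right : w (n ∸ i) ≤ c
    right = ≤c (m∸n≤m n i)

wordsF≤envelope : ∀ f k → wordsF f k ≤ envelope k
wordsF≤envelope zero    k       = z≤n
wordsF≤envelope (suc f) zero    = z≤n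
wordsF≤envelope (suc f) (suc n) = ≤-trans
  (wordsF-suc-≤ f n (envelope n) λ j≤n → ≤-trans (wordsF≤envelope f _) (envelope-mono j≤n))
  (envelope-recurrence n)

lemma7 : ∃[ C ] ∃[ N ] ((a b : ℤ) (k : ℕ) → a < b → b ≡ a + + k → N ≤ k →
    spaceA a b ≤ C * (4 ^ k * k ^ k))
lemma7 = 1 , 0 , λ { a .(a + + k) k _ refl _ →
  subst (λ m → wordsA ∣ m ∣ ≤ 1 * envelope k) (sym (xyx⁻¹≈y a (+ k)))
    (subst (wordsA k ≤_) (sym (*-identityˡ _)) (wordsF≤envelope k k)) }
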